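{- Let $\mathcal{T}$ be a BSTSO instance in which every tree has $2$, $3$ or $4$ elements, and let $\mathcal{T}^{\supsetneq 3}$ and $\mathcal{T}^{\mathrm{intersect}}$ be as defined below. Then $$\mathrm{opt}(\mathcal{T}\setminus\mathcal{T}^{\supsetneq 3})\ \ge\ \mathrm{opt}\big(\mathcal{T}\setminus(\mathcal{T}^{\supsetneq 3}\cup\mathcal{T}^{\mathrm{intersect}})\big)+|\mathcal{T}^{\mathrm{intersect}}|.$$
   Context: BSTSO: Fix an associative, commutative binary operator $\circ$ on $\{0,1\}$. An instance is a finite family $\mathcal{T}$ of subsets of $\{1,\dots,n\}$ (trees). A circuit is a directed acyclic graph with inputs (in-degree $0$, each associated with a variable $x_i$) and gates (in-degree $2$); each vertex $v$ has a variable set $S(v)$, with $S(v)=\{i\}$ for the input of $x_i$ and, for a gate with predecessors $u,w$, $S(u)\cap S(w)=\emptyset$ and $S(v)=S(u)\cup S(w)$. A solution for $\mathcal{T}$ is a circuit in which every $T\in\mathcal{T}$ equals $S(v)$ for some vertex $v$; its size is its number of gates; $\mathrm{opt}(\cdot)$ denotes the minimum size of a solution. Let $\mathcal{T}_i:=\{T\in\mathcal{T}:|T|=i\}$. Define $\mathcal{T}^{\supsetneq 3}:=\{T\in\mathcal{T}_4:\exists T'\in\mathcal{T}_3,\ T'\subsetneq T\}$. Define $\mathcal{T}^{\mathrm{intersect}}$ by the following greedy procedure: start with $B:=\mathcal{T}^{\supsetneq 3}$; while there exist $\ell\ge3$ distinct trees $T_1,\dots,T_\ell\in\mathcal{T}_4\setminus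 B$ with $|T_1\cap\dots\cap T_\ell|=3$, choose such trees and add them to $B$. $\mathcal{T}^{\mathrm{intersect}}$ is the set of all trees added to $B$ during this loop. -}

module Defs where

open import Data.Nat using (ℕ; zero; suc; _+_; _≤_)
open import Data.Fin using (Fin; zero; suc)
open import Data.Fin.Subset
  using (Subset; _∪_; _∩_; ⁅_⁆; ∣_∣; _⊂_; ⋂)
  renaming (⊥ to ∅)
open import Data.List using (List; []; _∷_; _++_; length; concat)
open import Data.List.Membership.Propositional using (_∈_; _∉_)
open import Data.List.Relation.Unary.All using (All)
open import Data.List.Relation.Unary.Unique.Propositional using (Unique)
open import Data.Product using (Σ; ∃; _×_; _,_)
open import Data.Sum using (_⊎_)
open import Data.Unit using (⊤)
open import Relation.Binary.PropositionalEquality using (_≡_)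
open import Relation.Nullary using (¬_)

-- Circuits over variables x_0,…,x_{n-1} (one input vertex per variable).
-- A circuit with m gates is a list of gates in topological order; each
-- gate picks two earlier vertices as predecessors.  Vertices of a circuit
-- with m gates are  Fin (m + n):  index 0 is the newest gate, and the
-- base case Fin (0 + n) = Fin n are the n inputs.

data Gates (n : ℕ) : ℕ → Set where
  input : Gates n 0
  _▷_ : ∀ {m} → Gates n m → Fin (m + n) × Fin (m + n) → Gates n (suc m)

vset : ∀ {n m} → Gates n m → Fin (m + n) → Subset n
vset input          i       = ⁅ i ⁆
vset (G ▷ (u , w)) zero    = vset G u ∪ vset G w
vset (G ▷ _)       (suc i) = vset G i

Valid : ∀ {n m} → Gates n m → Set
Valid input         = ⊤
Valid (G ▷ (u , w)) = Valid G × (vset G u ∩ vset G w ≡ ∅)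

SolvesExcept : ∀ {n m} → List (Subset n) → (Subset n → Set) → Gates n m → Set
SolvesExcept 𝒯 excluded G =
  ∀ T → T ∈ 𝒯 → ¬ excluded T → ∃ λ v → vset G v ≡ T

Sup3 : ∀ {n} → List (Subset n) → Subset n → Set
Sup3 𝒯 T = T ∈ 𝒯 × ∣ T ∣ ≡ 4 ×
           (∃ λ T′ → T′ ∈ 𝒯 × ∣ T′ ∣ ≡ 3 × T′ ⊂ T)

InB : ∀ {n} → List (Subset n) → List (Subset n) → Subset n → Set
InB 𝒯 added T = Sup3 𝒯 T ⊎ T ∈ added

-- a legal choice in the greedy loop: ℓ ≥ 3 distinct trees of 𝒯_4 ∖ B
-- whose common intersection has exactly 3 elements
Batch : ∀ {n} → List (Subset n) → List (Subset n) → List (Subset n) → Set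
Batch 𝒯 added b =
  3 ≤ length b × Unique b ×
  All (λ T → T ∈ 𝒯 × ∣ T ∣ ≡ 4 × ¬ InB 𝒯 added T) b ×
  ∣ ⋂ b ∣ ≡ 3

-- a complete (terminating) execution of the greedy loop, given as the
-- sequence of batches chosen, starting with the trees 'added' already in B
data GreedyRun {n} (𝒯 : List (Subset n)) (added : List (Subset n))
     : List (List (Subset n)) → Set where
  stop : ¬ (∃ λ b → Batch 𝒯 added b) → GreedyRun 𝒯 added []
  step : ∀ {b bs} → Batch 𝒯 added b → GreedyRun 𝒯 (added ++ b) bs →
         GreedyRun 𝒯 added (b ∷ bs)

-- 𝒯^intersect produced by the run bs is  concat bs  (a duplicate-free list)

{-# OPTIONS --safe #-}
module Submission where

-- Delete from a solution for 𝒯 ∖ 𝒯^{⊋3} every gate whose variable set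
-- contains a tree of 𝒯^intersect.  The surviving gates still form a circuit,
-- since the predecessors of a surviving gate survive.  The trees of
-- 𝒯^intersect are distinct and have four elements, so each is computed by its
-- own gate, and all these gates are deleted.  No remaining tree loses its
-- gate: it has at most four elements, so it contains a four-element tree only
-- if it is that tree.

open import Defs
open import Data.Nat using (ℕ; suc; _+_; _≤_; s≤s; z≤n)
open import Data.Nat.Properties using (≤-refl; ≤-trans; ≤-reflexive; +-monoʳ-≤; +-suc; ≤-pred; 1+n≰n)
open import Data.Fin using (zero; suc)
open import Data.Fin.Subset using (Subset; ∣_∣; _⊆_; _∪_; _∩_; inside; outside) renaming (⊥ to ∅)
open import Data.Fin.Subset.Properties
  using (_⊆?_; ⊆-refl; ⊆-trans; p⊆p∪q; q⊆p∪q; drop-∷-⊆; p⊆q⇒∣p∣≤∣q∣; ∣⁅x⁆∣≡1)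
open import Data.Vec using ([]; _∷_; here)
open import Data.List using (List; []; _∷_; _++_; length; concat)
open import Data.List.Properties using (length-++-sucʳ)
open import Data.List.Membership.Propositional using (_∈_; find; lose)
open import Data.List.Membership.Propositional.Properties using (∈-++⁺ˡ; ∈-++⁺ʳ; ∈-++⁻; ∈-∃++)
open import Data.List.Relation.Unary.All as All using (All; [])
open import Data.List.Relation.Unary.All.Properties as All using ()
open import Data.List.Relation.Unary.Any as Any using (Any; here; there; any?)
open import Data.List.Relation.Unary.AllPairs using ([]; _∷_)
open import Data.List.Relation.Unary.Unique.Propositional using (Unique)
open import Data.List.Relation.Unary.Unique.Propositional.Properties as Unique using ()
open import Data.Product using (Σ; ∃; _×_; _,_; proj₁; proj₂)
open import Data.Sum as Sum using (_⊎_; inj₁; inj₂)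
open import Function using (_∘_)
open import Relation.Binary.PropositionalEquality using (_≡_; refl; sym; trans; cong; cong₂; subst)
open import Relation.Nullary using (¬_; yes; no; contradiction)
open import Relation.Unary using (Decidable)

p⊆q∧∣q∣≤∣p∣⇒p≡q : ∀ {n} {p q : Subset n} → p ⊆ q → ∣ q ∣ ≤ ∣ p ∣ → p ≡ q
p⊆q∧∣q∣≤∣p∣⇒p≡q {p = []}          {[]}          _   _ = refl
p⊆q∧∣q∣≤∣p∣⇒p≡q {p = outside ∷ p} {outside ∷ q} p⊆q ∣q∣≤∣p∣ =
  cong (outside ∷_) (p⊆q∧∣q∣≤∣p∣⇒p≡q (drop-∷-⊆ p⊆q) ∣q∣≤∣p∣)
p⊆q∧∣q∣≤∣p∣⇒p≡q {p = inside  ∷ p} {inside  ∷ q} p⊆q ∣q∣≤∣p∣ =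
  cong (inside ∷_) (p⊆q∧∣q∣≤∣p∣⇒p≡q (drop-∷-⊆ p⊆q) (≤-pred ∣q∣≤∣p∣))
p⊆q∧∣q∣≤∣p∣⇒p≡q {p = inside  ∷ p} {outside ∷ q} p⊆q _ with p⊆q here
... | ()
p⊆q∧∣q∣≤∣p∣⇒p≡q {p = outside ∷ p} {inside  ∷ q} p⊆q ∣q∣≤∣p∣ =
  contradiction (≤-trans ∣q∣≤∣p∣ (p⊆q⇒∣p∣≤∣q∣ (drop-∷-⊆ p⊆q))) 1+n≰n

Unique∧⊆⇒length≤ : ∀ {A : Set} {xs ys : List A} → Unique xs →
  (∀ {x} → x ∈ xs → x ∈ ys) → length xs ≤ length ys
Unique∧⊆⇒length≤ {xs = []}     _              _     = z≤n
Unique∧⊆⇒length≤ {xs = x ∷ xs} (x∉xs ∷ unique) xs⊆ys with ∈-∃++ (xs⊆ys (here refl))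
... | as , bs , refl =
  ≤-trans (s≤s (Unique∧⊆⇒length≤ unique xs⊆as++bs)) (≤-reflexive (sym (length-++-sucʳ as x bs)))
  where
  xs⊆as++bs : ∀ {y} → y ∈ xs → y ∈ as ++ bs
  xs⊆as++bs y∈xs with ∈-++⁻ as (xs⊆ys (there y∈xs))
  ... | inj₁ y∈as          = ∈-++⁺ˡ y∈as
  ... | inj₂ (here refl)   = contradiction refl (All.lookup x∉xs y∈xs)
  ... | inj₂ (there y∈bs)  = ∈-++⁺ʳ as y∈bs

module Prune {n : ℕ} {Bad : Subset n → Set} (bad? : Decidable Bad)
             (bad-mono : ∀ {S S′} → S ⊆ S′ → Bad S → Bad S′) where

  record Pruning {m} (G : Gates n m) : Set where
    field
      size : ℕ
      circuit : Gates n size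
      valid : Valid circuit
      removed : List (Subset n)
      size+removed≡m : size + length removed ≡ m
      keeps : ∀ v → ¬ Bad (vset G v) → ∃ λ v′ → vset circuit v′ ≡ vset G v
      removes : ∀ v → Bad (vset G v) → 2 ≤ ∣ vset G v ∣ → vset G v ∈ removed

  open Pruning

  prune-input : Pruning (input {n})
  prune-input = record
    { size = 0 ; circuit = input ; valid = _ ; removed = [] ; size+removed≡m = refl
    ; keeps = λ v _ → v , refl
    ; removes = λ v _ 2≤∣v∣ → contradiction (subst (2 ≤_) (∣⁅x⁆∣≡1 v) 2≤∣v∣) 1+n≰n
    }

  remove-gate : ∀ {m} {G : Gates n m} {u w} → Pruning G →
    Bad (vset G u ∪ vset G w) → Pruning (G ▷ (u , w))
  remove-gate {G = G} {u} {w} P bad = record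
    { size = size P ; circuit = circuit P ; valid = valid P
    ; removed = vset G u ∪ vset G w ∷ removed P
    ; size+removed≡m = trans (+-suc (size P) _) (cong suc (size+removed≡m P))
    ; keeps = λ { zero ¬bad → contradiction bad ¬bad ; (suc v) → keeps P v }
    ; removes = λ { zero _ _ → here refl ; (suc v) bad′ 2≤ → there (removes P v bad′ 2≤) }
    }

  keep-gate : ∀ {m} {G : Gates n m} {u w} → Pruning G →
    vset G u ∩ vset G w ≡ ∅ → ¬ Bad (vset G u ∪ vset G w) → Pruning (G ▷ (u , w))
  keep-gate {G = G} {u} {w} P disjoint ¬bad
    with u′ , u′≡u ← keeps P u (¬bad ∘ bad-mono (p⊆p∪q (vset G w)))
       | w′ , w′≡w ← keeps P w (¬bad ∘ bad-mono (q⊆p∪q (vset G u) (vset G w)))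
    = record
    { size = suc (size P) ; circuit = circuit P ▷ (u′ , w′)
    ; valid = valid P , trans (cong₂ _∩_ u′≡u w′≡w) disjoint
    ; removed = removed P ; size+removed≡m = cong suc (size+removed≡m P)
    ; keeps = λ { zero _ → zero , cong₂ _∪_ u′≡u w′≡w
                ; (suc v) ¬bad′ → let v′ , v′≡v = keeps P v ¬bad′ in suc v′ , v′≡v }
    ; removes = λ { zero bad → contradiction bad ¬bad ; (suc v) → removes P v }
    }

  prune : ∀ {m} (G : Gates n m) → Valid G → Pruning G
  prune input _ = prune-input
  prune (G ▷ (u , w)) (valid-G , disjoint) with bad? (vset G u ∪ vset G w)
  ... | yes bad = remove-gate (prune G valid-G) bad
  ... | no ¬bad = keep-gate (prune G valid-G) disjoint ¬bad

ContainsSome : ∀ {n} → List (Subset n) → Subset n → Set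
ContainsSome R S = Any (_⊆ S) R

ContainsSome? : ∀ {n} (R : List (Subset n)) → Decidable (ContainsSome R)
ContainsSome? R S = any? (_⊆? S) R

ContainsSome-mono : ∀ {n} {R : List (Subset n)} {S S′} → S ⊆ S′ →
  ContainsSome R S → ContainsSome R S′
ContainsSome-mono {S = S} {S′} S⊆S′ = Any.map {P = _⊆ S} {Q = _⊆ S′} (λ T⊆S → ⊆-trans T⊆S S⊆S′)

ContainsSome⇒∈ : ∀ {n k} {R : List (Subset n)} {S} → All (λ T → ∣ T ∣ ≡ k) R →
  ∣ S ∣ ≤ k → ContainsSome R S → S ∈ R
ContainsSome⇒∈ sizes ∣S∣≤k contains with T , T∈R , T⊆S ← find contains =
  subst (_∈ _) (p⊆q∧∣q∣≤∣p∣⇒p≡q T⊆S (subst (_ ≤_) (sym (All.lookup sizes T∈R)) ∣S∣≤k)) T∈R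

Fresh : ∀ {n} → List (Subset n) → List (Subset n) → Subset n → Set
Fresh 𝒯 added T = T ∈ 𝒯 × ∣ T ∣ ≡ 4 × ¬ InB 𝒯 added T

Fresh-++⁻ : ∀ {n} {𝒯 added b : List (Subset n)} {T} → Fresh 𝒯 (added ++ b) T → Fresh 𝒯 added T
Fresh-++⁻ (T∈𝒯 , ∣T∣≡4 , ∉B) = T∈𝒯 , ∣T∣≡4 , ∉B ∘ Sum.map₂ ∈-++⁺ˡ

GreedyRun⇒All-Fresh : ∀ {n} {𝒯 added : List (Subset n)} {bs} →
  GreedyRun 𝒯 added bs → All (Fresh 𝒯 added) (concat bs)
GreedyRun⇒All-Fresh (stop _) = []
GreedyRun⇒All-Fresh (step (_ , _ , fresh , _) run) =
  All.++⁺ fresh (All.map Fresh-++⁻ (GreedyRun⇒All-Fresh run))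

GreedyRun⇒Unique : ∀ {n} {𝒯 added : List (Subset n)} {bs} →
  GreedyRun 𝒯 added bs → Unique (concat bs)
GreedyRun⇒Unique (stop _) = []
GreedyRun⇒Unique {added = added} (step (_ , unique , _ , _) run) =
  Unique.++⁺ unique (GreedyRun⇒Unique run) λ (T∈b , T∈later) →
    proj₂ (proj₂ (All.lookup (GreedyRun⇒All-Fresh run) T∈later)) (inj₂ (∈-++⁺ʳ added T∈b))

size≤4 : ∀ {k} → k ≡ 2 ⊎ k ≡ 3 ⊎ k ≡ 4 → k ≤ 4
size≤4 (inj₁ refl)        = s≤s (s≤s z≤n)
size≤4 (inj₂ (inj₁ refl)) = s≤s (s≤s (s≤s z≤n))
size≤4 (inj₂ (inj₂ refl)) = ≤-refl

lemma7 : (n : ℕ) (𝒯 : List (Subset n)) →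
    All (λ T → ∣ T ∣ ≡ 2 ⊎ ∣ T ∣ ≡ 3 ⊎ ∣ T ∣ ≡ 4) 𝒯 →
    (bs : List (List (Subset n))) → GreedyRun 𝒯 [] bs →
    (m : ℕ) (G : Gates n m) → Valid G → SolvesExcept 𝒯 (Sup3 𝒯) G →
    Σ ℕ λ m′ → Σ (Gates n m′) λ G′ → Valid G′ ×
      SolvesExcept 𝒯 (λ T → Sup3 𝒯 T ⊎ T ∈ concat bs) G′ ×
      m′ + length (concat bs) ≤ m
lemma7 n 𝒯 sizes bs run m G valid-G solves =
  size P , circuit P , valid P , solves′ ,
  ≤-trans (+-monoʳ-≤ (size P) (Unique∧⊆⇒length≤ (GreedyRun⇒Unique run) R⊆removed))
          (≤-reflexive (size+removed≡m P))
  where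
  R : List (Subset n)
  R = concat bs

  fresh : All (Fresh 𝒯 []) R
  fresh = GreedyRun⇒All-Fresh run

  open Prune (ContainsSome? R) ContainsSome-mono
  open Pruning

  P : Pruning G
  P = prune G valid-G

  R⊆removed : ∀ {T} → T ∈ R → T ∈ removed P
  R⊆removed T∈R with T∈𝒯 , ∣T∣≡4 , ∉B ← All.lookup fresh T∈R
                with v , refl ← solves _ T∈𝒯 (∉B ∘ inj₁) =
    removes P v (lose T∈R ⊆-refl) (subst (2 ≤_) (sym ∣T∣≡4) (s≤s (s≤s z≤n)))

  solves′ : SolvesExcept 𝒯 (λ T → Sup3 𝒯 T ⊎ T ∈ R) (circuit P)
  solves′ T T∈𝒯 excluded with v , refl ← solves T T∈𝒯 (excluded ∘ inj₁) =
    keeps P v (excluded ∘ inj₂ ∘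
      ContainsSome⇒∈ (All.map (proj₁ ∘ proj₂) fresh) (size≤4 (All.lookup sizes T∈𝒯)))
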